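{- Let $S$ be a string, $a, b$ characters with $a \neq b$, and $x$ a string. If $ax \in \mathsf{M}(aS)$, $x \notin \mathsf{M}(aS)$, $bax \notin \mathsf{M}(aS)$, $x \in \mathsf{M}(S)$, and $bax \notin \mathsf{M}(S)$, then $bax \notin \mathsf{M}(bS)$.
   Context: Strings are finite sequences of characters from an alphabet $\Sigma$; $\varepsilon$ is the empty string. For a string $T$, $\mathrm{Substr}(T)$ is its set of substrings (including $\varepsilon$). A substring $u$ of $T$ is left-maximal in $T$ if $u$ is a prefix of $T$ or there are distinct characters $c \neq d$ with $cu, du \in \mathrm{Substr}(T)$; it is right-maximal in $T$ if $u$ is a suffix of $T$ or there are distinct characters $c\neq d$ with $uc, ud \in \mathrm{Substr}(T)$. $\mathsf{M}(T)$ is the set of substrings of $T$ that are both left- and right-maximal. -}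

module Defs where

open import Data.List using (List; []; _∷_; _++_)
open import Data.Product using (Σ; ∃; ∃-syntax; _×_; _,_)
open import Data.Sum using (_⊎_)
open import Relation.Nullary using (¬_)
open import Relation.Binary.PropositionalEquality using (_≡_)
open import Level using (Level)

private variable ℓ : Level

module _ {A : Set ℓ} where

  Substr : List A → List A → Set ℓ
  Substr u T = ∃[ p ] ∃[ q ] (T ≡ p ++ u ++ q)

  IsPrefix : List A → List A → Set ℓ
  IsPrefix u T = ∃[ q ] (T ≡ u ++ q)

  IsSuffix : List A → List A → Set ℓ
  IsSuffix u T = ∃[ p ] (T ≡ p ++ u)

  LeftMaximal : List A → List A → Set ℓ
  LeftMaximal u T =
    Substr u T ×
    (IsPrefix u T ⊎ (∃[ c ] ∃[ d ] (¬ c ≡ d × Substr (c ∷ u) T × Substr (d ∷ u) T)))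

  RightMaximal : List A → List A → Set ℓ
  RightMaximal u T =
    Substr u T ×
    (IsSuffix u T ⊎ (∃[ c ] ∃[ d ] (¬ c ≡ d × Substr (u ++ c ∷ []) T × Substr (u ++ d ∷ []) T)))

  M : List A → List A → Set ℓ
  M u T = LeftMaximal u T × RightMaximal u T

-- If ax were a prefix of S, the occurrence of x at the front of S would
-- reappear right after the new first letter of aS, so every witness of
-- x ∈ M(S) would survive in aS; since x ∉ M(aS), ax is not a prefix of S.
-- Consequently bax is not a prefix of bS, and a non-prefix loses nothing
-- when the first letter of the text is removed: its occurrences, left and
-- right extensions all lie in S, except a left extension at the front,
-- which makes it a prefix of S. Hence bax ∈ M(bS) would give bax ∈ M(S).
module Submission where

open import Defs
open import Data.List using (List; []; _∷_; _++_; length)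
open import Data.List.Properties using (++-assoc; ++-identityʳ; ∷-injective)
open import Data.Nat using (_≤_; s≤s)
open import Data.Nat.Properties using (n≤1+n)
open import Data.Product using (_,_; proj₂)
open import Data.Sum using (_⊎_; inj₁; inj₂)
open import Function using (_∘_)
open import Relation.Nullary using (¬_; contradiction)
open import Relation.Binary.PropositionalEquality using (_≡_; refl; sym; trans; cong)

module _ {ℓ} {A : Set ℓ} where

  IsPrefix-∷⁺ : ∀ (c : A) {u T} → IsPrefix u T → IsPrefix (c ∷ u) (c ∷ T)
  IsPrefix-∷⁺ c (q , T≡) = q , cong (c ∷_) T≡

  IsPrefix-∷⁻ : ∀ {c d : A} {u T} → IsPrefix (c ∷ u) (d ∷ T) → IsPrefix u T
  IsPrefix-∷⁻ (q , T≡) = q , proj₂ (∷-injective T≡)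

  IsPrefix-++⁻ : ∀ {u v T : List A} → IsPrefix (u ++ v) T → IsPrefix u T
  IsPrefix-++⁻ {u} {v} (q , T≡) = v ++ q , trans T≡ (++-assoc u v q)

  IsPrefix-trans : ∀ {u v T : List A} → IsPrefix u v → IsPrefix v T → IsPrefix u T
  IsPrefix-trans {u} (k , refl) (q , refl) = k ++ q , ++-assoc u k q

  IsPrefix-shorter : ∀ {u v T : List A} → IsPrefix u T → IsPrefix v T →
                     length u ≤ length v → IsPrefix u v
  IsPrefix-shorter {[]}    {v}     _        _        _ = v , refl
  IsPrefix-shorter {_ ∷ _} {[]}    _        _        ()
  IsPrefix-shorter {c ∷ u} {d ∷ v} {[]}    (_ , ()) _ _
  IsPrefix-shorter {c ∷ u} {d ∷ v} {e ∷ T} u≤T v≤T (s≤s u≤v)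
    with refl , _ ← ∷-injective (proj₂ u≤T) | refl , _ ← ∷-injective (proj₂ v≤T) =
    IsPrefix-∷⁺ c (IsPrefix-shorter (IsPrefix-∷⁻ u≤T) (IsPrefix-∷⁻ v≤T) u≤v)

  Substr-∷⁺ : ∀ (c : A) {u T} → Substr u T → Substr u (c ∷ T)
  Substr-∷⁺ c (p , q , T≡) = c ∷ p , q , cong (c ∷_) T≡

  Substr-∷⁻ : ∀ {c : A} {u T} → Substr u (c ∷ T) → IsPrefix u (c ∷ T) ⊎ Substr u T
  Substr-∷⁻ ([]    , q , T≡) = inj₁ (q , T≡)
  Substr-∷⁻ (_ ∷ p , q , T≡) with refl , T≡′ ← ∷-injective T≡ = inj₂ (p , q , T≡′)

  IsSuffix-∷⁻ : ∀ {c : A} {u T} → IsSuffix u (c ∷ T) → IsPrefix u (c ∷ T) ⊎ IsSuffix u T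
  IsSuffix-∷⁻ {u = u} ([]    , T≡) = inj₁ ([] , trans T≡ (sym (++-identityʳ u)))
  IsSuffix-∷⁻         (_ ∷ p , T≡) with refl , T≡′ ← ∷-injective T≡ = inj₂ (p , T≡′)

  RightMaximal-∷⁺ : ∀ (c : A) {u T} → RightMaximal u T → RightMaximal u (c ∷ T)
  RightMaximal-∷⁺ c (occ , inj₁ (p , T≡)) = Substr-∷⁺ c occ , inj₁ (c ∷ p , cong (c ∷_) T≡)
  RightMaximal-∷⁺ c (occ , inj₂ (d , e , d≢e , ud , ue)) =
    Substr-∷⁺ c occ , inj₂ (d , e , d≢e , Substr-∷⁺ c ud , Substr-∷⁺ c ue)

  -- The only witness that can fail to lift is "x is a prefix of T"; the
  -- hypothesis makes x a prefix of ax, hence of aT.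
  LeftMaximal-∷⁺ : ∀ {a : A} {x T} → IsPrefix (a ∷ x) T →
                   LeftMaximal x T → LeftMaximal x (a ∷ T)
  LeftMaximal-∷⁺ {a} ax≤T (occ , inj₁ x≤T) =
    Substr-∷⁺ a occ ,
    inj₁ (IsPrefix-trans (IsPrefix-shorter x≤T ax≤T (n≤1+n _)) (IsPrefix-∷⁺ a x≤T))
  LeftMaximal-∷⁺ {a} _ (occ , inj₂ (d , e , d≢e , du , eu)) =
    Substr-∷⁺ a occ , inj₂ (d , e , d≢e , Substr-∷⁺ a du , Substr-∷⁺ a eu)

  M-∷⁺ : ∀ {a : A} {x T} → IsPrefix (a ∷ x) T → M x T → M x (a ∷ T)
  M-∷⁺ {a} ax≤T (L , R) = LeftMaximal-∷⁺ ax≤T L , RightMaximal-∷⁺ a R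

  Substr-∷⁻-nonPrefix : ∀ {c : A} {u T} → ¬ IsPrefix u (c ∷ T) → Substr u (c ∷ T) → Substr u T
  Substr-∷⁻-nonPrefix u≰cT occ with Substr-∷⁻ occ
  ... | inj₁ u≤cT = contradiction u≤cT u≰cT
  ... | inj₂ occ′ = occ′

  LeftMaximal-∷⁻ : ∀ {c : A} {u T} → ¬ IsPrefix u (c ∷ T) →
                   LeftMaximal u (c ∷ T) → LeftMaximal u T
  LeftMaximal-∷⁻ u≰cT (_ , inj₁ u≤cT) = contradiction u≤cT u≰cT
  LeftMaximal-∷⁻ u≰cT (occ , inj₂ (d , e , d≢e , du , eu))
    with Substr-∷⁻ du | Substr-∷⁻ eu
  ... | inj₁ du≤cT | _          = Substr-∷⁻-nonPrefix u≰cT occ , inj₁ (IsPrefix-∷⁻ du≤cT)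
  ... | inj₂ _     | inj₁ eu≤cT = Substr-∷⁻-nonPrefix u≰cT occ , inj₁ (IsPrefix-∷⁻ eu≤cT)
  ... | inj₂ du′   | inj₂ eu′   = Substr-∷⁻-nonPrefix u≰cT occ , inj₂ (d , e , d≢e , du′ , eu′)

  RightMaximal-∷⁻ : ∀ {c : A} {u T} → ¬ IsPrefix u (c ∷ T) →
                    RightMaximal u (c ∷ T) → RightMaximal u T
  RightMaximal-∷⁻ u≰cT (occ , inj₁ u≥cT) with IsSuffix-∷⁻ u≥cT
  ... | inj₁ u≤cT = contradiction u≤cT u≰cT
  ... | inj₂ u≥T  = Substr-∷⁻-nonPrefix u≰cT occ , inj₁ u≥T
  RightMaximal-∷⁻ u≰cT (occ , inj₂ (d , e , d≢e , ud , ue)) =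
    Substr-∷⁻-nonPrefix u≰cT occ ,
    inj₂ (d , e , d≢e , Substr-∷⁻-nonPrefix (u≰cT ∘ IsPrefix-++⁻) ud
                      , Substr-∷⁻-nonPrefix (u≰cT ∘ IsPrefix-++⁻) ue)

  M-∷⁻ : ∀ {c : A} {u T} → ¬ IsPrefix u (c ∷ T) → M u (c ∷ T) → M u T
  M-∷⁻ u≰cT (L , R) = LeftMaximal-∷⁻ u≰cT L , RightMaximal-∷⁻ u≰cT R

lemma9 : ∀ {ℓ} {A : Set ℓ} (S : List A) (a b : A) (x : List A) →
    ¬ a ≡ b →
    M (a ∷ x) (a ∷ S) →
    ¬ M x (a ∷ S) →
    ¬ M (b ∷ a ∷ x) (a ∷ S) →
    M x S →
    ¬ M (b ∷ a ∷ x) S →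
    ¬ M (b ∷ a ∷ x) (b ∷ S)
lemma9 S a b x _ _ x∉M[aS] _ x∈M[S] bax∉M[S] =
  bax∉M[S] ∘ M-∷⁻ (ax≰S ∘ IsPrefix-∷⁻)
  where
  ax≰S : ¬ IsPrefix (a ∷ x) S
  ax≰S ax≤S = x∉M[aS] (M-∷⁺ ax≤S x∈M[S])
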